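{- Let $\mathbb P=(P,(P_p)_{p\in P},(\vdash^p)_{p\in P})$ be a continuous stratified conjunctive logic, $p\in P$, $\Gamma\in\mathcal P_f(\mathcal L(P_p))\cup\{\{p\}\}$ and $\psi\in\mathcal L(P_p)$. If $\Gamma\vdash^p\psi$, then there is some $\varphi\in\mathcal L(P_p)$ with $\Gamma\vdash^p\varphi$ and $\varphi\vdash^p\psi$.
   Context: Let $P$ be a set of atomic propositions containing a constant $\top$ ("true"). For $Q\subseteq P$, $\mathcal L(Q)$ is the set of formulae built from the elements of $Q$ by the binary connective $\wedge$. For a nonempty finite set $\Gamma=\{\varphi_1,\dots,\varphi_n\}$ of formulae, $\bigwedge\Gamma=\varphi_1\wedge\dots\wedge\varphi_n$ (bracketed to the left), and $\bigwedge\emptyset=\top$. $\mathcal P_f(M)$ denotes the set of finite subsets of $M$. In sequents the left side is a finite set; "$\Delta,\varphi$" means $\Delta\cup\{\varphi\}$ and a single formula $\varphi$ stands for $\{\varphi\}$. A stratified conjunctive logic $\mathbb P=(P,(P_p)_{p\in P},(\vdash^p)_{p\in P})$ consists of such $P$, subsets $P_p\subseteq P$ and relations $\vdash^p\subseteq(\mathcal P_f(\mathcal L(P_p))\cup\{\{p\}\})\times\mathcal L(P_p)$ such that for all $p,q\in P$, $\Gamma\in\mathcal P_f(\mathcal L(P_p))\cup\{\{p\}\}$, $\Delta\in\mathcal P_f(\mathcal L(P_p))$ and $\varphi,\psi,\theta,\xi\in\mathcal L(P_p)$: (1) if $q\in P_p$ then $p\vdash^pq$; (2) if $q\vdash^qp$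 then $P_p\subseteq P_q$; (3) if $q\vdash^qp$ and $\Gamma\vdash^p\theta$ then $\Gamma\vdash^q\theta$; (4) $\vdash^p$ is closed under: (R$\top$) $\Gamma\vdash^p\top$; (L$\wedge$) $\Delta,\varphi,\psi\vdash^p\theta$ iff $\Delta,\varphi\wedge\psi\vdash^p\theta$; (R$\wedge$) ($\Gamma\vdash^p\varphi$ and $\Gamma\vdash^p\psi$) iff $\Gamma\vdash^p\varphi\wedge\psi$; (Cut) $\Gamma\vdash^p\varphi$ and $\varphi\vdash^p\psi$ imply $\Gamma\vdash^p\psi$; (W) $\Delta\vdash^p\varphi$ implies $\Delta,\xi\vdash^p\varphi$. It is continuous if (INT): for all $p\in P$, $\Gamma\in\mathcal P_f(\mathcal L(P_p))\cup\{\{p\}\}$, $\varphi\in\mathcal L(P_p)$, if $\Gamma\vdash^p\varphi$ then there are $r\in P_p$ and $\xi\in\mathcal L(P_r)$ with $\Gamma\vdash^p r\wedge\xi$ and $\xi\vdash^r\varphi$. -}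

module Defs where

open import Data.Product using (Σ; _×_; _,_)
open import Data.Sum using (_⊎_)
open import Data.List using (List; []; _∷_)
open import Data.List.Relation.Unary.All using (All)
open import Data.List.Membership.Propositional using (_∈_)
open import Function.Bundles using (_⇔_)

infixl 6 _∧_

data Fm (A : Set) : Set where
  atom : A → Fm A
  _∧_  : Fm A → Fm A → Fm A

-- φ ∈ 𝓛(Q): all atoms of φ lie in Q (Q given as a predicate on atoms).
data InL {A : Set} (Q : A → Set) : Fm A → Set where
  atom : ∀ {a} → Q a → InL Q (atom a)
  _∧_  : ∀ {φ ψ} → InL Q φ → InL Q ψ → InL Q (φ ∧ ψ)

-- Finite sets of formulae are represented by lists; two lists denote the
-- same finite set when they have the same members.
_≈ₛ_ : {A : Set} → List (Fm A) → List (Fm A) → Set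
Γ ≈ₛ Γ' = ∀ x → (x ∈ Γ) ⇔ (x ∈ Γ')

-- Γ ∈ 𝒫_f(𝓛(Q)) ∪ {{a}}
Ctx : {A : Set} → (A → Set) → A → List (Fm A) → Set
Ctx Q a Γ = All (InL Q) Γ ⊎ (Γ ≈ₛ (atom a ∷ []))

-- A stratified conjunctive logic.
--   P       : the set of atomic propositions, with constant top (⊤)
--   Pp p q  : q ∈ P_p
--   ⊢ p Γ φ : Γ ⊢^p φ
record SCL : Set₁ where
  field
    P   : Set
    top : P
    Pp  : P → P → Set
    ⊢   : P → List (Fm P) → Fm P → Set

  L : P → Fm P → Set
  L p = InL (Pp p)

  C : P → List (Fm P) → Set
  C p = Ctx (Pp p) p

  field
    domain : ∀ {p Γ φ} → ⊢ p Γ φ → C p Γ × L p φ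
    -- left sides are finite sets: ⊢ only depends on the set of members
    setInv : ∀ {p Γ Γ' φ} → Γ ≈ₛ Γ' → ⊢ p Γ φ → ⊢ p Γ' φ
    -- (1)
    ax1 : ∀ {p q} → Pp p q → ⊢ p (atom p ∷ []) (atom q)
    -- (2)
    ax2 : ∀ {p q} → ⊢ q (atom q ∷ []) (atom p) → ∀ r → Pp p r → Pp q r
    -- (3)
    ax3 : ∀ {p q Γ θ} → ⊢ q (atom q ∷ []) (atom p) → C p Γ → L p θ →
          ⊢ p Γ θ → ⊢ q Γ θ
    rtop : ∀ {p Γ} → C p Γ → ⊢ p Γ (atom top)
    land : ∀ {p Δ φ ψ θ} → All (L p) Δ → L p φ → L p ψ → L p θ →
           ⊢ p (φ ∷ ψ ∷ Δ) θ ⇔ ⊢ p ((φ ∧ ψ) ∷ Δ) θ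
    rand : ∀ {p Γ φ ψ} → C p Γ → L p φ → L p ψ →
           (⊢ p Γ φ × ⊢ p Γ ψ) ⇔ ⊢ p Γ (φ ∧ ψ)
    cut : ∀ {p Γ φ ψ} → C p Γ → L p φ → L p ψ →
          ⊢ p Γ φ → ⊢ p (φ ∷ []) ψ → ⊢ p Γ ψ
    weak : ∀ {p Δ φ ξ} → All (L p) Δ → L p φ → L p ξ →
           ⊢ p Δ φ → ⊢ p (ξ ∷ Δ) φ

Continuous : SCL → Set
Continuous 𝕃 = ∀ {p Γ φ} → C p Γ → L p φ → ⊢ p Γ φ →
  Σ P λ r → Pp p r × Σ (Fm P) λ ξ → L r ξ × ⊢ p Γ (atom r ∧ ξ) × ⊢ r (ξ ∷ []) φ
  where open SCL 𝕃

{-# OPTIONS --safe #-}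
-- Continuity yields r ∈ P_p and ξ ∈ 𝓛(P_r) with Γ ⊢^p r ∧ ξ and ξ ⊢^r ψ, so
-- φ = r ∧ ξ is the interpolant. Since p ⊢^p r by (1), axioms (2) and (3) move
-- ξ and the derivation ξ ⊢^r ψ into stratum p, and weakening by r followed by
-- (L∧) turns ξ ⊢^p ψ into r ∧ ξ ⊢^p ψ.
module Submission where

open import Defs
open import Data.Product using (Σ; _×_; _,_; proj₁; proj₂)
open import Data.List using (List; []; _∷_)
open import Data.List.Relation.Unary.All using ([]; _∷_)
open import Function.Bundles using (Equivalence)

InL-map : {A : Set} {Q Q′ : A → Set} → (∀ {a} → Q a → Q′ a) →
          ∀ {φ} → InL Q φ → InL Q′ φ
InL-map f (atom q) = atom (f q)
InL-map f (φ ∧ ψ)  = InL-map f φ ∧ InL-map f ψ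

module _ (𝕃 : SCL) where
  open SCL 𝕃

  L-mono : ∀ {p r φ} → Pp p r → L r φ → L p φ
  L-mono r∈Pp = InL-map (ax2 (ax1 r∈Pp) _)

  ⊢-lift : ∀ {p r Γ θ} → Pp p r → ⊢ r Γ θ → ⊢ p Γ θ
  ⊢-lift r∈Pp Γ⊢θ = ax3 (ax1 r∈Pp) (proj₁ (domain Γ⊢θ)) (proj₂ (domain Γ⊢θ)) Γ⊢θ

  ∧-weakenˡ : ∀ {p φ ψ θ} → L p φ → L p ψ →
              ⊢ p (ψ ∷ []) θ → ⊢ p (φ ∧ ψ ∷ []) θ
  ∧-weakenˡ {p} {θ = θ} φ∈L ψ∈L ψ⊢θ =
    Equivalence.to (land [] φ∈L ψ∈L θ∈L) (weak (ψ∈L ∷ []) θ∈L φ∈L ψ⊢θ)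
    where
    θ∈L : L p θ
    θ∈L = proj₂ (domain ψ⊢θ)

lemma7p5 : (𝕃 : SCL) → Continuous 𝕃 →
    let open SCL 𝕃 in
    (p : P) (Γ : List (Fm P)) (ψ : Fm P) → C p Γ → L p ψ → ⊢ p Γ ψ →
    Σ (Fm P) λ φ → L p φ × ⊢ p Γ φ × ⊢ p (φ ∷ []) ψ
lemma7p5 𝕃 continuous p Γ ψ Γ∈C ψ∈L Γ⊢ψ
  with continuous Γ∈C ψ∈L Γ⊢ψ
... | r , r∈Pp , ξ , ξ∈Lr , Γ⊢r∧ξ , ξ⊢ʳψ =
  atom r ∧ ξ , r∧ξ∈L , Γ⊢r∧ξ , ∧-weakenˡ 𝕃 r∈L ξ∈L (⊢-lift 𝕃 r∈Pp ξ⊢ʳψ)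
  where
  open SCL 𝕃
  r∈L : L p (atom r)
  r∈L = atom r∈Pp
  ξ∈L : L p ξ
  ξ∈L = L-mono 𝕃 r∈Pp ξ∈Lr
  r∧ξ∈L : L p (atom r ∧ ξ)
  r∧ξ∈L = r∈L ∧ ξ∈L
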